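{- Let $k\ge 7$ be an odd integer and let $G$ be a graph with no induced $P_k$ and with no cycle (as a subgraph) of odd length at most $k-4$. Let $C=v_1v_2\cdots v_k$ be an induced cycle of length $k$ in $G$, indices taken modulo $k$. Then every vertex $v\notin V(C)$ that has at least one neighbour on $C$ satisfies exactly one of the following for some $1\le i\le k$: (i) the neighbours of $v$ on $C$ are exactly $v_i$ and $v_{i+2}$; (ii) the neighbours of $v$ on $C$ are exactly $v_i$ and $v_{i+4}$; (iii) the neighbours of $v$ on $C$ are exactly $v_i$, $v_{i+2}$ and $v_{i+4}$.
   Context: All graphs are finite and simple; $P_k$ denotes the path on $k$ vertices. -}

module Defs where

open import Data.Nat using (ℕ; suc; _+_; _≤_; _%_; NonZero)
open import Data.Nat.DivMod using (m%n<n)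
open import Data.Fin using (Fin; toℕ; fromℕ<)
open import Data.Bool using (Bool; true; false)
open import Data.Product using (Σ; _×_; ∃)
open import Data.Sum using (_⊎_)
open import Relation.Binary.PropositionalEquality using (_≡_)
open import Relation.Nullary using (¬_)
open import Function.Bundles using (_⇔_)
open import Function.Definitions using (Injective)

record Graph (n : ℕ) : Set where
  field
    adj  : Fin n → Fin n → Bool
    sym  : ∀ u v → adj u v ≡ adj v u
    irr  : ∀ v → adj v v ≡ false

open Graph public

_∼[_]_ : ∀ {n} → Fin n → Graph n → Fin n → Set
u ∼[ G ] v = adj G u v ≡ true

shift : ∀ {k} .{{_ : NonZero k}} → Fin k → ℕ → Fin k
shift {k} i d = fromℕ< (m%n<n (toℕ i + d) k)

IsInducedPath : ∀ {n} (G : Graph n) (k : ℕ) → (Fin k → Fin n) → Set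
IsInducedPath G k p =
  Injective _≡_ _≡_ p ×
  (∀ i j → (p i ∼[ G ] p j) ⇔ (toℕ j ≡ suc (toℕ i) ⊎ toℕ i ≡ suc (toℕ j)))

HasInducedPath : ∀ {n} → Graph n → ℕ → Set
HasInducedPath {n} G k = Σ (Fin k → Fin n) (IsInducedPath G k)

IsInducedCycle : ∀ {n} (G : Graph n) (k : ℕ) .{{_ : NonZero k}} → (Fin k → Fin n) → Set
IsInducedCycle G k c =
  Injective _≡_ _≡_ c ×
  (∀ i j → (c i ∼[ G ] c j) ⇔ (j ≡ shift i 1 ⊎ i ≡ shift j 1))

HasCycleOfLength : ∀ {n} → Graph n → ℕ → Set
HasCycleOfLength {n} G ℓ =
  Σ ℕ λ m → ℓ ≡ suc m × 3 ≤ ℓ ×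
  Σ (Fin (suc m) → Fin n) λ c →
    Injective _≡_ _≡_ c × (∀ i → c i ∼[ G ] c (shift i 1))

NbrsOnCycleExactly : ∀ {n k} (G : Graph n) → (Fin k → Fin n) → Fin n → (Fin k → Set) → Set
NbrsOnCycleExactly G c v S = ∀ j → (v ∼[ G ] c j) ⇔ S j

module Submission where

-- Fix a neighbour c a of v.  Any second neighbour c (a+d) splits C into
-- two arcs of lengths d and k - d; as k is odd one arc is odd, and together
-- with v an odd arc of length e closes an odd cycle of length e + 2, so
-- e ≥ k - 5 and the other (even) arc has length 2 or 4.  Hence all neighbours
-- lie among a, a±2, a±4.  The pairs {a+2, a-4}, {a+4, a-2}, {a+4, a-4} again
-- span short odd arcs, and if c a is the only neighbour then v, c a, …,
-- c (a+k-2) is an induced P_k.  The remaining eight configurations are exactly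
-- the three types; these are mutually exclusive since offsets 0, …, 6 from a
-- position of C are distinct.

open import Defs hiding (sym)
open import Data.Nat using (ℕ; zero; suc; _+_; _*_; _∸_; _≤_; _<_; _%_; _/_; _≤?_; _<?_; NonZero; z≤n; s≤s)
open import Data.Nat.Properties
  using (+-comm; +-assoc; +-cancelˡ-≡; +-cancelʳ-<; ≤-refl; ≤-trans; ≤-reflexive; <-trans; <⇒≤; ≤-pred;
         ≰⇒>; ≤∧≮⇒≡; suc-injective; n<1+n; m≤m+n; m≤n+m; m+n≤o⇒m≤o∸n; m+[n∸m]≡n; m<n⇒0<n∸m)
open import Data.Nat.DivMod
  using (m%n<n; m%n%n≡m%n; %-distribˡ-+; [m+n]%n≡m%n; [m+kn]%n≡m%n; m<n⇒m%n≡m; n%n≡0; m≡m%n+[m/n]*n)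
open import Data.Fin using (Fin; toℕ)
open import Data.Fin.Properties using (toℕ-fromℕ<; toℕ-injective; toℕ<n)
open import Data.Product using (_×_; ∃; _,_; proj₁; proj₂)
open import Data.Sum using (_⊎_; inj₁; inj₂)
import Data.Sum
open import Data.Empty using (⊥; ⊥-elim)
open import Data.Bool using (true)
import Data.Bool.Properties as Bool
open import Relation.Binary.PropositionalEquality
  using (_≡_; refl; sym; trans; cong; subst; subst₂; module ≡-Reasoning)
open import Relation.Nullary using (¬_; Dec; yes; no)
open import Relation.Nullary.Decidable using (True; toWitness)
open import Function.Bundles using (Equivalence; mk⇔; _⇔_)
open Equivalence using (to; from)

module CyclicIndex {k : ℕ} .{{_ : NonZero k}} where
  open ≡-Reasoning

  toℕ-shift : ∀ (i : Fin k) d → toℕ (shift i d) ≡ (toℕ i + d) % k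
  toℕ-shift i d = toℕ-fromℕ< _

  %-absorbˡ : ∀ m d → (m % k + d) % k ≡ (m + d) % k
  %-absorbˡ m d = begin
    (m % k + d) % k          ≡⟨ %-distribˡ-+ (m % k) d k ⟩
    (m % k % k + d % k) % k  ≡⟨ cong (λ x → (x + d % k) % k) (m%n%n≡m%n m k) ⟩
    (m % k + d % k) % k      ≡⟨ %-distribˡ-+ m d k ⟨
    (m + d) % k              ∎

  %-absorbʳ : ∀ m d → (m + d % k) % k ≡ (m + d) % k
  %-absorbʳ m d = begin
    (m + d % k) % k  ≡⟨ cong (_% k) (+-comm m (d % k)) ⟩
    (d % k + m) % k  ≡⟨ %-absorbˡ d m ⟩
    (d + m) % k      ≡⟨ cong (_% k) (+-comm d m) ⟩
    (m + d) % k      ∎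

  toℕ-mod : ∀ (i : Fin k) → toℕ i % k ≡ toℕ i
  toℕ-mod i = m<n⇒m%n≡m (toℕ<n i)

  shift-+ : ∀ (i : Fin k) a b → shift (shift i a) b ≡ shift i (a + b)
  shift-+ i a b = toℕ-injective (begin
    toℕ (shift (shift i a) b)  ≡⟨ toℕ-shift (shift i a) b ⟩
    (toℕ (shift i a) + b) % k  ≡⟨ cong (λ x → (x + b) % k) (toℕ-shift i a) ⟩
    ((toℕ i + a) % k + b) % k  ≡⟨ %-absorbˡ (toℕ i + a) b ⟩
    (toℕ i + a + b) % k        ≡⟨ cong (_% k) (+-assoc (toℕ i) a b) ⟩
    (toℕ i + (a + b)) % k      ≡⟨ toℕ-shift i (a + b) ⟨
    toℕ (shift i (a + b))      ∎)

  shift-zero : ∀ (i : Fin k) → shift i 0 ≡ i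
  shift-zero i = toℕ-injective (begin
    toℕ (shift i 0)    ≡⟨ toℕ-shift i 0 ⟩
    (toℕ i + 0) % k    ≡⟨ cong (_% k) (+-comm (toℕ i) 0) ⟩
    toℕ i % k          ≡⟨ toℕ-mod i ⟩
    toℕ i              ∎)

  shift-around : ∀ (i : Fin k) d e → d + e ≡ k → shift (shift i d) e ≡ i
  shift-around i d e d+e≡k = toℕ-injective (begin
    toℕ (shift (shift i d) e)  ≡⟨ cong toℕ (shift-+ i d e) ⟩
    toℕ (shift i (d + e))      ≡⟨ toℕ-shift i (d + e) ⟩
    (toℕ i + (d + e)) % k      ≡⟨ cong (λ x → (toℕ i + x) % k) d+e≡k ⟩
    (toℕ i + k) % k            ≡⟨ [m+n]%n≡m%n (toℕ i) k ⟩
    toℕ i % k                  ≡⟨ toℕ-mod i ⟩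
    toℕ i                      ∎)

  shift-back : ∀ (i : Fin k) m → (toℕ i + (m + (k ∸ toℕ i))) % k ≡ m % k
  shift-back i m = begin
    (toℕ i + (m + (k ∸ toℕ i))) % k  ≡⟨ cong (λ x → (toℕ i + x) % k) (+-comm m (k ∸ toℕ i)) ⟩
    (toℕ i + (k ∸ toℕ i + m)) % k    ≡⟨ cong (_% k) (+-assoc (toℕ i) (k ∸ toℕ i) m) ⟨
    (toℕ i + (k ∸ toℕ i) + m) % k    ≡⟨ cong (λ x → (x + m) % k) (m+[n∸m]≡n (<⇒≤ (toℕ<n i))) ⟩
    (k + m) % k                      ≡⟨ cong (_% k) (+-comm k m) ⟩
    (m + k) % k                      ≡⟨ [m+n]%n≡m%n m k ⟩
    m % k                            ∎

  shift-injective : ∀ (i : Fin k) a b → a < k → b < k → shift i a ≡ shift i b → a ≡ b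
  shift-injective i a b a<k b<k eq = begin
    a                                              ≡⟨ undo a a<k ⟨
    toℕ (shift (shift i a) (k ∸ toℕ i))            ≡⟨ cong (λ j → toℕ (shift j (k ∸ toℕ i))) eq ⟩
    toℕ (shift (shift i b) (k ∸ toℕ i))            ≡⟨ undo b b<k ⟩
    b                                              ∎
    where
    undo : ∀ m → m < k → toℕ (shift (shift i m) (k ∸ toℕ i)) ≡ m
    undo m m<k = begin
      toℕ (shift (shift i m) (k ∸ toℕ i))  ≡⟨ cong toℕ (shift-+ i m (k ∸ toℕ i)) ⟩
      toℕ (shift i (m + (k ∸ toℕ i)))      ≡⟨ toℕ-shift i _ ⟩
      (toℕ i + (m + (k ∸ toℕ i))) % k      ≡⟨ shift-back i m ⟩
      m % k                                ≡⟨ m<n⇒m%n≡m m<k ⟩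
      m                                    ∎

  shift-injective-suc : ∀ (i : Fin k) s t → s < k → suc t < k → shift i s ≡ shift (shift i t) 1 → s ≡ suc t
  shift-injective-suc i s t s<k t+1<k eq = trans
    (shift-injective i s (t + 1) s<k (subst (_< k) (+-comm 1 t) t+1<k) (trans eq (shift-+ i t 1)))
    (+-comm t 1)

  shift-surjective : ∀ (i j : Fin k) → ∃ λ d → d < k × j ≡ shift i d
  shift-surjective i j = d , m%n<n _ k , sym (toℕ-injective (begin
    toℕ (shift i d)                         ≡⟨ toℕ-shift i d ⟩
    (toℕ i + d) % k                         ≡⟨ %-absorbʳ (toℕ i) (toℕ j + (k ∸ toℕ i)) ⟩
    (toℕ i + (toℕ j + (k ∸ toℕ i))) % k     ≡⟨ shift-back i (toℕ j) ⟩
    toℕ j % k                               ≡⟨ toℕ-mod j ⟩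
    toℕ j                                   ∎))
    where
    d : ℕ
    d = (toℕ j + (k ∸ toℕ i)) % k

  shift-one : ∀ (i : Fin k) → suc (toℕ i) < k → toℕ (shift i 1) ≡ suc (toℕ i)
  shift-one i i+1<k = begin
    toℕ (shift i 1)    ≡⟨ toℕ-shift i 1 ⟩
    (toℕ i + 1) % k    ≡⟨ cong (_% k) (+-comm (toℕ i) 1) ⟩
    suc (toℕ i) % k    ≡⟨ m<n⇒m%n≡m i+1<k ⟩
    suc (toℕ i)        ∎

  shift-one-last : ∀ (i : Fin k) → suc (toℕ i) ≡ k → toℕ (shift i 1) ≡ 0
  shift-one-last i i+1≡k = begin
    toℕ (shift i 1)    ≡⟨ toℕ-shift i 1 ⟩
    (toℕ i + 1) % k    ≡⟨ cong (_% k) (trans (+-comm (toℕ i) 1) i+1≡k) ⟩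
    k % k              ≡⟨ n%n≡0 k ⟩
    0                  ∎

open CyclicIndex

odd-sum : ∀ d e → (d + e) % 2 ≡ 1 → (d % 2 ≡ 1 × e % 2 ≡ 0) ⊎ (d % 2 ≡ 0 × e % 2 ≡ 1)
odd-sum d e odd =
  residues (d % 2) (e % 2) (m%n<n d 2) (m%n<n e 2) (trans (sym (%-distribˡ-+ d e 2)) odd)
  where
  residues : ∀ x y → x < 2 → y < 2 → (x + y) % 2 ≡ 1 → (x ≡ 1 × y ≡ 0) ⊎ (x ≡ 0 × y ≡ 1)
  residues 0 0 _ _ ()
  residues 0 1 _ _ _ = inj₂ (refl , refl)
  residues 1 0 _ _ _ = inj₁ (refl , refl)
  residues 1 1 _ _ ()
  residues (suc (suc _)) _ (s≤s (s≤s ())) _ _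
  residues _ (suc (suc _)) _ (s≤s (s≤s ())) _

even-below-6 : ∀ d → 1 ≤ d → d < 6 → d % 2 ≡ 0 → d ≡ 2 ⊎ d ≡ 4
even-below-6 2 _ _ _ = inj₁ refl
even-below-6 4 _ _ _ = inj₂ refl
even-below-6 1 _ _ ()
even-below-6 3 _ _ ()
even-below-6 5 _ _ ()
even-below-6 (suc (suc (suc (suc (suc (suc _)))))) _ (s≤s (s≤s (s≤s (s≤s (s≤s (s≤s ())))))) _

odd-from-7 : ∀ k → 7 ≤ k → k % 2 ≡ 1 → ∃ λ q → k ≡ 7 + q * 2
odd-from-7 k 7≤k odd = halves (k / 2) 7≤k (trans (m≡m%n+[m/n]*n k 2) (cong (_+ (k / 2) * 2) odd))
  where
  halves : ∀ h → 7 ≤ k → k ≡ 1 + h * 2 → ∃ λ q → k ≡ 7 + q * 2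
  halves (suc (suc (suc q))) _ k≡ = q , k≡
  halves 0 7≤k refl with 7≤k
  ... | s≤s ()
  halves 1 7≤k refl with 7≤k
  ... | s≤s (s≤s (s≤s ()))
  halves 2 7≤k refl with 7≤k
  ... | s≤s (s≤s (s≤s (s≤s (s≤s ()))))

-- A vertex v off an induced cycle c of length k.  The fan from position x is the
-- sequence v, c x, c (x+1), c (x+2), …; its initial segments give the cycles
-- and paths used in the argument.
module Fan {k : ℕ} .{{_ : NonZero k}} {n : ℕ} (G : Graph n) (c : Fin k → Fin n)
           (cycle : IsInducedCycle G k c) (v : Fin n) (v∉c : ∀ i → ¬ v ≡ c i) where

  ∼-sym : ∀ {x y} → x ∼[ G ] y → y ∼[ G ] x
  ∼-sym {x} {y} x∼y = trans (Graph.sym G y x) x∼y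

  c-step : ∀ i d → c (shift i d) ∼[ G ] c (shift i (suc d))
  c-step i d = from (proj₂ cycle (shift i d) (shift i (suc d)))
    (inj₁ (trans (cong (shift i) (+-comm 1 d)) (sym (shift-+ i d 1))))

  c-adjacent : ∀ x s t → suc s < k → suc t < k →
               c (shift x s) ∼[ G ] c (shift x t) → t ≡ suc s ⊎ s ≡ suc t
  c-adjacent x s t s+1<k t+1<k adj with to (proj₂ cycle (shift x s) (shift x t)) adj
  ... | inj₁ t≡s+1 = inj₁ (shift-injective-suc x t s (<-trans (n<1+n t) t+1<k) s+1<k t≡s+1)
  ... | inj₂ s≡t+1 = inj₂ (shift-injective-suc x s t (<-trans (n<1+n s) s+1<k) t+1<k s≡t+1)

  fan : Fin k → ℕ → Fin n
  fan x zero    = v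
  fan x (suc t) = c (shift x t)

  fan-injective : ∀ x s t → s ≤ k → t ≤ k → fan x s ≡ fan x t → s ≡ t
  fan-injective x zero    zero    _   _   _  = refl
  fan-injective x zero    (suc t) _   _   eq = ⊥-elim (v∉c _ eq)
  fan-injective x (suc s) zero    _   _   eq = ⊥-elim (v∉c _ (sym eq))
  fan-injective x (suc s) (suc t) s≤k t≤k eq = cong suc (shift-injective x s t s≤k t≤k (proj₁ cycle eq))

  fan-step : ∀ {x} → v ∼[ G ] c x → ∀ t → fan x t ∼[ G ] fan x (suc t)
  fan-step {x} v∼x zero    = subst (λ j → v ∼[ G ] c j) (sym (shift-zero x)) v∼x
  fan-step     _   (suc t) = c-step _ t

  chord-cycle : ∀ x d → v ∼[ G ] c x → v ∼[ G ] c (shift x d) → 1 ≤ d → d < k →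
                HasCycleOfLength G (2 + d)
  chord-cycle x d v∼x v∼x+d 1≤d d<k =
    suc d , refl , s≤s (s≤s 1≤d) , vertex , vertex-injective , closed-walk
    where
    vertex : Fin (2 + d) → Fin n
    vertex i = fan x (toℕ i)

    within : ∀ (i : Fin (2 + d)) → toℕ i ≤ k
    within i = ≤-trans (≤-pred (toℕ<n i)) d<k

    vertex-injective : ∀ {i j} → vertex i ≡ vertex j → i ≡ j
    vertex-injective {i} {j} eq = toℕ-injective (fan-injective x _ _ (within i) (within j) eq)

    closed-walk : ∀ i → vertex i ∼[ G ] vertex (shift i 1)
    closed-walk i with suc (toℕ i) <? 2 + d
    ... | yes i+1<ℓ = subst (λ m → vertex i ∼[ G ] fan x m) (sym (shift-one i i+1<ℓ)) (fan-step v∼x (toℕ i))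
    ... | no  i+1≮ℓ = subst₂ (λ m m′ → fan x m ∼[ G ] fan x m′)
                        (sym (suc-injective last)) (sym (shift-one-last i last)) (∼-sym v∼x+d)
      where
      last : suc (toℕ i) ≡ 2 + d
      last = ≤∧≮⇒≡ (toℕ<n i) i+1≮ℓ

  -- If c a is the only neighbour of v on the cycle, the fan at a cut off after k
  -- vertices, v, c a, …, c (a + k - 2), is an induced path.
  pendant-path : ∀ a → v ∼[ G ] c a → (∀ j → v ∼[ G ] c j → j ≡ a) → HasInducedPath G k
  pendant-path a v∼a only-a = vertex , vertex-injective , λ i j → fan-adjacent (toℕ i) (toℕ j) (toℕ<n i) (toℕ<n j)
    where
    vertex : Fin k → Fin n
    vertex i = fan a (toℕ i)

    vertex-injective : ∀ {i j} → vertex i ≡ vertex j → i ≡ j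
    vertex-injective {i} {j} eq = toℕ-injective (fan-injective a _ _ (<⇒≤ (toℕ<n i)) (<⇒≤ (toℕ<n j)) eq)

    v≁v : ¬ v ∼[ G ] v
    v≁v v∼v with trans (sym v∼v) (Graph.irr G v)
    ... | ()

    only-first : ∀ t → suc t < k → v ∼[ G ] c (shift a t) → suc t ≡ 1
    only-first t t+1<k v∼a+t = cong suc (shift-injective a t 0 (<-trans (n<1+n t) t+1<k) (<-trans (s≤s z≤n) t+1<k)
                                 (trans (only-a _ v∼a+t) (sym (shift-zero a))))

    fan-adjacent : ∀ s t → s < k → t < k → (fan a s ∼[ G ] fan a t) ⇔ (t ≡ suc s ⊎ s ≡ suc t)
    fan-adjacent zero zero _ _ = mk⇔ (λ v∼v → ⊥-elim (v≁v v∼v)) λ { (inj₁ ()) ; (inj₂ ()) }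
    fan-adjacent zero (suc t) _ t+1<k =
      mk⇔ (λ adj → inj₁ (only-first t t+1<k adj)) λ { (inj₁ refl) → fan-step v∼a 0 ; (inj₂ ()) }
    fan-adjacent (suc s) zero s+1<k _ =
      mk⇔ (λ adj → inj₂ (only-first s s+1<k (∼-sym adj))) λ { (inj₂ refl) → ∼-sym (fan-step v∼a 0) ; (inj₁ ()) }
    fan-adjacent (suc s) (suc t) s+1<k t+1<k =
      mk⇔ (λ adj → Data.Sum.map (cong suc) (cong suc) (c-adjacent a s t s+1<k t+1<k adj))
          λ { (inj₁ refl) → c-step a s ; (inj₂ refl) → ∼-sym (c-step a t) }

module Types {k : ℕ} .{{_ : NonZero k}} {n : ℕ} (G : Graph n) (c : Fin k → Fin n) (v : Fin n) where

  TypeA TypeB TypeC : Fin k → Set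
  TypeA i = NbrsOnCycleExactly G c v (λ j → j ≡ i ⊎ j ≡ shift i 2)
  TypeB i = NbrsOnCycleExactly G c v (λ j → j ≡ i ⊎ j ≡ shift i 4)
  TypeC i = NbrsOnCycleExactly G c v (λ j → j ≡ i ⊎ j ≡ shift i 2 ⊎ j ≡ shift i 4)

  ExactlyOneType : Set
  ExactlyOneType = (∃ TypeA × ¬ ∃ TypeB × ¬ ∃ TypeC)
                 ⊎ (¬ ∃ TypeA × ∃ TypeB × ¬ ∃ TypeC)
                 ⊎ (¬ ∃ TypeA × ¬ ∃ TypeB × ∃ TypeC)

  -- On a cycle of length at least 7 the three types are pairwise incompatible,
  -- because offsets 0, …, 6 from a position are all distinct.
  module Incompatible (7≤k : 7 ≤ k) where

    distinct : ∀ i x y {x≤6 : True (x ≤? 6)} {y≤6 : True (y ≤? 6)} → ¬ x ≡ y → ¬ shift i x ≡ shift i y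
    distinct i x y {x≤6} {y≤6} x≢y eq = x≢y (shift-injective i x y (below x≤6) (below y≤6) eq)
      where
      below : ∀ {m} → True (m ≤? 6) → m < k
      below m≤6 = ≤-trans (s≤s (toWitness m≤6)) 7≤k

    distinct₀ : ∀ i x {x≤6 : True (x ≤? 6)} → ¬ x ≡ 0 → ¬ shift i x ≡ i
    distinct₀ i x {x≤6} x≢0 eq = distinct i x 0 {x≤6} x≢0 (trans eq (sym (shift-zero i)))

    -- Under type A at i, the neighbours i′ and i′+4 of a type B at i′ would both
    -- lie in {i, i+2}; every choice identifies two distinct small offsets.
    A-not-B : ∀ i i′ → TypeA i → TypeB i′ → ⊥
    A-not-B i i′ typeA typeB with to (typeA i′) (from (typeB i′) (inj₁ refl))
                                | to (typeA (shift i′ 4)) (from (typeB _) (inj₂ refl))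
    ... | inj₁ refl | inj₁ eq = distinct₀ i 4 (λ ()) eq
    ... | inj₁ refl | inj₂ eq = distinct i 4 2 (λ ()) eq
    ... | inj₂ refl | inj₁ eq = distinct₀ i 6 (λ ()) (trans (sym (shift-+ i 2 4)) eq)
    ... | inj₂ refl | inj₂ eq = distinct i 6 2 (λ ()) (trans (sym (shift-+ i 2 4)) eq)

    -- Likewise the type C neighbours i′, i′+2, i′+4 do not fit into {i, i+2}.
    A-not-C : ∀ i i′ → TypeA i → TypeC i′ → ⊥
    A-not-C i i′ typeA typeC with to (typeA i′) (from (typeC i′) (inj₁ refl))
    ... | inj₁ refl with to (typeA (shift i 4)) (from (typeC _) (inj₂ (inj₂ refl)))
    ...   | inj₁ eq = distinct₀ i 4 (λ ()) eq
    ...   | inj₂ eq = distinct i 4 2 (λ ()) eq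
    A-not-C i i′ typeA typeC | inj₂ refl with to (typeA (shift (shift i 2) 2)) (from (typeC _) (inj₂ (inj₁ refl)))
    ...   | inj₁ eq = distinct₀ i 4 (λ ()) (trans (sym (shift-+ i 2 2)) eq)
    ...   | inj₂ eq = distinct i 4 2 (λ ()) (trans (sym (shift-+ i 2 2)) eq)

    -- … nor into {i, i+4}.
    B-not-C : ∀ i i′ → TypeB i → TypeC i′ → ⊥
    B-not-C i i′ typeB typeC with to (typeB i′) (from (typeC i′) (inj₁ refl))
    ... | inj₁ refl with to (typeB (shift i 2)) (from (typeC _) (inj₂ (inj₁ refl)))
    ...   | inj₁ eq = distinct₀ i 2 (λ ()) eq
    ...   | inj₂ eq = distinct i 2 4 (λ ()) eq
    B-not-C i i′ typeB typeC | inj₂ refl with to (typeB (shift (shift i 4) 2)) (from (typeC _) (inj₂ (inj₁ refl)))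
    ...   | inj₁ eq = distinct₀ i 6 (λ ()) (trans (sym (shift-+ i 4 2)) eq)
    ...   | inj₂ eq = distinct i 6 4 (λ ()) (trans (sym (shift-+ i 4 2)) eq)

    exactly-one : ∃ TypeA ⊎ ∃ TypeB ⊎ ∃ TypeC → ExactlyOneType
    exactly-one (inj₁ (i , typeA)) =
      inj₁ ((i , typeA) , (λ (i′ , typeB) → A-not-B i i′ typeA typeB) , λ (i′ , typeC) → A-not-C i i′ typeA typeC)
    exactly-one (inj₂ (inj₁ (i , typeB))) =
      inj₂ (inj₁ ((λ (i′ , typeA) → A-not-B i′ i typeA typeB) , (i , typeB) , λ (i′ , typeC) → B-not-C i i′ typeB typeC))
    exactly-one (inj₂ (inj₂ (i , typeC))) =
      inj₂ (inj₂ ((λ (i′ , typeA) → A-not-C i′ i typeA typeC) , (λ (i′ , typeB) → B-not-C i′ i typeB typeC) , (i , typeC)))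

complement-unique : ∀ {k} d e f → d + e ≡ k → e + f ≡ k → d ≡ f
complement-unique d e f d+e≡k e+f≡k = +-cancelˡ-≡ e d f (trans (+-comm e d) (trans d+e≡k (sym e+f≡k)))

module Neighbourhood (q : ℕ) {n : ℕ} (G : Graph n)
    (no-short-odd-cycle : ∀ ℓ → ℓ % 2 ≡ 1 → ℓ ≤ (7 + q * 2) ∸ 4 → ¬ HasCycleOfLength G ℓ)
    (c : Fin (7 + q * 2) → Fin n) (cycle : IsInducedCycle G (7 + q * 2) c)
    (v : Fin n) (v∉c : ∀ i → ¬ v ≡ c i) where

  k : ℕ
  k = 7 + q * 2

  open Fan G c cycle v v∉c
  open Types G c v

  k-odd : k % 2 ≡ 1
  k-odd = [m+kn]%n≡m%n 7 q 2

  -- The length k - 6 = 2q + 1 of the arcs between far candidates is odd.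
  k∸6-odd : (1 + q * 2) % 2 ≡ 1
  k∸6-odd = [m+kn]%n≡m%n 1 q 2

  _∼?_ : ∀ x y → Dec (x ∼[ G ] y)
  x ∼? y = adj G x y Bool.≟ true

  along : ∀ {i j} → i ≡ j → v ∼[ G ] c i → v ∼[ G ] c j
  along = subst (λ j → v ∼[ G ] c j)

  -- v cannot see both ends of an odd arc of length e ≤ k - 6: with v the arc
  -- would close an odd cycle of length e + 2 ≤ k - 4.
  no-short-odd-arc : ∀ x e → v ∼[ G ] c x → v ∼[ G ] c (shift x e) → e % 2 ≡ 1 → 6 + e ≤ k → ⊥
  no-short-odd-arc x zero _ _ ()
  no-short-odd-arc x e@(suc _) v∼x v∼x+e e-odd short =
    no-short-odd-cycle (2 + e) cycle-odd cycle-short (chord-cycle x e v∼x v∼x+e (s≤s z≤n) e<k)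
    where
    cycle-odd : (2 + e) % 2 ≡ 1
    cycle-odd = trans (cong (_% 2) (+-comm 2 e)) (trans ([m+n]%n≡m%n e 2) e-odd)
    cycle-short : 2 + e ≤ k ∸ 4
    cycle-short = m+n≤o⇒m≤o∸n (2 + e) (subst (_≤ k) (cong (2 +_) (+-comm 4 e)) short)
    e<k : e < k
    e<k = ≤-trans (m≤n+m (suc e) 5) short

  even-complement : ∀ x d e → d + e ≡ k → 1 ≤ d → d % 2 ≡ 0 → e % 2 ≡ 1 →
                    v ∼[ G ] c x → v ∼[ G ] c (shift x e) → d ≡ 2 ⊎ d ≡ 4
  even-complement x d e d+e≡k 1≤d d-even e-odd v∼x v∼x+e with 6 + e ≤? k
  ... | yes short = ⊥-elim (no-short-odd-arc x e v∼x v∼x+e e-odd short)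
  ... | no  long  = even-below-6 d 1≤d (+-cancelʳ-< e d 6 (subst (_< 6 + e) (sym d+e≡k) (≰⇒> long))) d-even

  -- Two neighbours of v split the cycle into arcs of lengths d and e, one of
  -- which is odd since k is; hence the other one has length 2 or 4.
  short-arc : ∀ a d e → d + e ≡ k → 1 ≤ d → 1 ≤ e → v ∼[ G ] c a → v ∼[ G ] c (shift a d) →
              d ≡ 2 ⊎ d ≡ 4 ⊎ e ≡ 2 ⊎ e ≡ 4
  short-arc a d e d+e≡k 1≤d 1≤e v∼a v∼a+d with odd-sum d e (subst (λ m → m % 2 ≡ 1) (sym d+e≡k) k-odd)
  ... | inj₁ (d-odd , e-even) =
    inj₂ (inj₂ (even-complement a e d (trans (+-comm e d) d+e≡k) 1≤e e-even d-odd v∼a v∼a+d))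
  ... | inj₂ (d-even , e-odd) =
    Data.Sum.map₂ inj₁ (even-complement (shift a d) d e d+e≡k 1≤d d-even e-odd v∼a+d
                                          (along (sym (shift-around a d e d+e≡k)) v∼a))

  module Around (a : Fin k) (v∼a : v ∼[ G ] c a) where

    a+2 a+4 a-2 a-4 : Fin k
    a+2 = shift a 2
    a+4 = shift a 4
    a-2 = shift a (5 + q * 2)
    a-4 = shift a (3 + q * 2)

    arcs : ∀ {d} → d < k → d + (k ∸ d) ≡ k
    arcs d<k = m+[n∸m]≡n (<⇒≤ d<k)

    candidates : ∀ j → v ∼[ G ] c j → j ≡ a ⊎ j ≡ a+2 ⊎ j ≡ a+4 ⊎ j ≡ a-2 ⊎ j ≡ a-4
    candidates j v∼j with shift-surjective a j
    ... | zero , _ , refl = inj₁ (shift-zero a)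
    ... | d@(suc _) , d<k , refl
      with short-arc a d (k ∸ d) (arcs d<k) (s≤s z≤n) (m<n⇒0<n∸m d<k) v∼a v∼j
    ...   | inj₁ d≡2               = inj₂ (inj₁ (cong (shift a) d≡2))
    ...   | inj₂ (inj₁ d≡4)        = inj₂ (inj₂ (inj₁ (cong (shift a) d≡4)))
    ...   | inj₂ (inj₂ (inj₁ e≡2)) = inj₂ (inj₂ (inj₂ (inj₁ (cong (shift a)
            (complement-unique d (k ∸ d) (5 + q * 2) (arcs d<k) (cong (_+ (5 + q * 2)) e≡2))))))
    ...   | inj₂ (inj₂ (inj₂ e≡4)) = inj₂ (inj₂ (inj₂ (inj₂ (cong (shift a)
            (complement-unique d (k ∸ d) (3 + q * 2) (arcs d<k) (cong (_+ (3 + q * 2)) e≡4))))))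

    -- Candidates at odd distance at most k - 6 cannot both be neighbours.
    not-a+2-and-a-4 : v ∼[ G ] c a+2 → v ∼[ G ] c a-4 → ⊥
    not-a+2-and-a-4 v∼a+2 v∼a-4 =
      no-short-odd-arc a+2 (1 + q * 2) v∼a+2 (along (sym (shift-+ a 2 (1 + q * 2))) v∼a-4) k∸6-odd ≤-refl

    not-a+4-and-a-2 : v ∼[ G ] c a+4 → v ∼[ G ] c a-2 → ⊥
    not-a+4-and-a-2 v∼a+4 v∼a-2 =
      no-short-odd-arc a+4 (1 + q * 2) v∼a+4 (along (sym (shift-+ a 4 (1 + q * 2))) v∼a-2) k∸6-odd ≤-refl

    -- For k = 7 the candidates a+4 and a-4 are adjacent on the cycle; for k ≥ 9
    -- they are joined by an arc of odd length k - 8.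
    not-a+4-and-a-4 : v ∼[ G ] c a+4 → v ∼[ G ] c a-4 → ⊥
    not-a+4-and-a-4 v∼a+4 v∼a-4 = by-size q refl
      where
      by-size : ∀ r → q ≡ r → ⊥
      by-size zero q≡0 = no-short-odd-arc a-4 1 v∼a-4 (along (sym a-4+1≡a+4) v∼a+4) refl (m≤m+n 7 (q * 2))
        where
        a-4+1≡a+4 : shift a-4 1 ≡ a+4
        a-4+1≡a+4 = trans (shift-+ a (3 + q * 2) 1) (cong (λ r → shift a (3 + r * 2 + 1)) q≡0)
      by-size (suc p) q≡p+1 = no-short-odd-arc a+4 (1 + p * 2) v∼a+4 (along (sym a+4+gap≡a-4) v∼a-4)
          ([m+kn]%n≡m%n 1 p 2) (≤-trans (m≤n+m (7 + p * 2) 2) (≤-reflexive (cong (λ r → 7 + r * 2) (sym q≡p+1))))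
        where
        a+4+gap≡a-4 : shift a+4 (1 + p * 2) ≡ a-4
        a+4+gap≡a-4 = trans (shift-+ a 4 (1 + p * 2)) (cong (λ r → shift a (3 + r * 2)) (sym q≡p+1))

    a-2+2≡a : shift a-2 2 ≡ a
    a-2+2≡a = shift-around a (5 + q * 2) 2 (+-comm (5 + q * 2) 2)

    a-4+4≡a : shift a-4 4 ≡ a
    a-4+4≡a = shift-around a (3 + q * 2) 4 (+-comm (3 + q * 2) 4)

    a-4+2≡a-2 : shift a-4 2 ≡ a-2
    a-4+2≡a-2 = trans (shift-+ a (3 + q * 2) 2) (cong (shift a) (+-comm (3 + q * 2) 2))

    a-2+4≡a+2 : shift a-2 4 ≡ a+2
    a-2+4≡a+2 = trans (sym (shift-+ a-2 2 2)) (cong (λ j → shift j 2) a-2+2≡a)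

    Settles : (Fin k → Set) → Fin k → Set
    Settles S j = S j ⊎ ¬ v ∼[ G ] c j

    exactly : (S : Fin k → Set) → (∀ j → S j → v ∼[ G ] c j) →
              Settles S a → Settles S a+2 → Settles S a+4 → Settles S a-2 → Settles S a-4 →
              NbrsOnCycleExactly G c v S
    exactly S sound s₀ s₁ s₂ s₃ s₄ j = mk⇔ complete (sound j)
      where
      settled : ∀ {x} → Settles S x → j ≡ x → v ∼[ G ] c j → S j
      settled (inj₁ x∈S) refl _   = x∈S
      settled (inj₂ x≁v) refl v∼x = ⊥-elim (x≁v v∼x)
      complete : v ∼[ G ] c j → S j
      complete v∼j with candidates j v∼j
      ... | inj₁ eq                         = settled s₀ eq v∼j
      ... | inj₂ (inj₁ eq)                  = settled s₁ eq v∼j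
      ... | inj₂ (inj₂ (inj₁ eq))           = settled s₂ eq v∼j
      ... | inj₂ (inj₂ (inj₂ (inj₁ eq)))    = settled s₃ eq v∼j
      ... | inj₂ (inj₂ (inj₂ (inj₂ eq)))    = settled s₄ eq v∼j

    lone-neighbour : ¬ v ∼[ G ] c a+2 → ¬ v ∼[ G ] c a+4 → ¬ v ∼[ G ] c a-2 → ¬ v ∼[ G ] c a-4 →
                     ∀ j → v ∼[ G ] c j → j ≡ a
    lone-neighbour v≁a+2 v≁a+4 v≁a-2 v≁a-4 j v∼j with candidates j v∼j
    ... | inj₁ j≡a                           = j≡a
    ... | inj₂ (inj₁ refl)                   = ⊥-elim (v≁a+2 v∼j)
    ... | inj₂ (inj₂ (inj₁ refl))            = ⊥-elim (v≁a+4 v∼j)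
    ... | inj₂ (inj₂ (inj₂ (inj₁ refl)))     = ⊥-elim (v≁a-2 v∼j)
    ... | inj₂ (inj₂ (inj₂ (inj₂ refl)))     = ⊥-elim (v≁a-4 v∼j)

    some-type : ¬ HasInducedPath G k → ∃ TypeA ⊎ ∃ TypeB ⊎ ∃ TypeC
    some-type no-path with v ∼? c a+2 | v ∼? c a+4 | v ∼? c a-2 | v ∼? c a-4
    ... | no v≁a+2 | no v≁a+4 | no v≁a-2 | no v≁a-4 =
      ⊥-elim (no-path (pendant-path a v∼a (lone-neighbour v≁a+2 v≁a+4 v≁a-2 v≁a-4)))
    ... | yes v∼a+2 | no v≁a+4 | no v≁a-2 | no v≁a-4 =
      inj₁ (a , exactly _ (λ { _ (inj₁ refl) → v∼a ; _ (inj₂ refl) → v∼a+2 })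
                  (inj₁ (inj₁ refl)) (inj₁ (inj₂ refl)) (inj₂ v≁a+4) (inj₂ v≁a-2) (inj₂ v≁a-4))
    ... | no v≁a+2 | yes v∼a+4 | no v≁a-2 | no v≁a-4 =
      inj₂ (inj₁ (a , exactly _ (λ { _ (inj₁ refl) → v∼a ; _ (inj₂ refl) → v∼a+4 })
                        (inj₁ (inj₁ refl)) (inj₂ v≁a+2) (inj₁ (inj₂ refl)) (inj₂ v≁a-2) (inj₂ v≁a-4)))
    ... | yes v∼a+2 | yes v∼a+4 | no v≁a-2 | no v≁a-4 =
      inj₂ (inj₂ (a , exactly _ (λ { _ (inj₁ refl) → v∼a ; _ (inj₂ (inj₁ refl)) → v∼a+2 ; _ (inj₂ (inj₂ refl)) → v∼a+4 })
                        (inj₁ (inj₁ refl)) (inj₁ (inj₂ (inj₁ refl))) (inj₁ (inj₂ (inj₂ refl))) (inj₂ v≁a-2) (inj₂ v≁a-4)))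
    ... | no v≁a+2 | no v≁a+4 | yes v∼a-2 | no v≁a-4 =
      inj₁ (a-2 , exactly _ (λ { _ (inj₁ refl) → v∼a-2 ; _ (inj₂ refl) → along (sym a-2+2≡a) v∼a })
                    (inj₁ (inj₂ (sym a-2+2≡a))) (inj₂ v≁a+2) (inj₂ v≁a+4) (inj₁ (inj₁ refl)) (inj₂ v≁a-4))
    ... | no v≁a+2 | no v≁a+4 | no v≁a-2 | yes v∼a-4 =
      inj₂ (inj₁ (a-4 , exactly _ (λ { _ (inj₁ refl) → v∼a-4 ; _ (inj₂ refl) → along (sym a-4+4≡a) v∼a })
                          (inj₁ (inj₂ (sym a-4+4≡a))) (inj₂ v≁a+2) (inj₂ v≁a+4) (inj₂ v≁a-2) (inj₁ (inj₁ refl))))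
    ... | no v≁a+2 | no v≁a+4 | yes v∼a-2 | yes v∼a-4 =
      inj₂ (inj₂ (a-4 , exactly _ (λ { _ (inj₁ refl) → v∼a-4 ; _ (inj₂ (inj₁ refl)) → along (sym a-4+2≡a-2) v∼a-2
                                     ; _ (inj₂ (inj₂ refl)) → along (sym a-4+4≡a) v∼a })
                          (inj₁ (inj₂ (inj₂ (sym a-4+4≡a)))) (inj₂ v≁a+2) (inj₂ v≁a+4)
                          (inj₁ (inj₂ (inj₁ (sym a-4+2≡a-2)))) (inj₁ (inj₁ refl))))
    ... | yes v∼a+2 | no v≁a+4 | yes v∼a-2 | no v≁a-4 =
      inj₂ (inj₂ (a-2 , exactly _ (λ { _ (inj₁ refl) → v∼a-2 ; _ (inj₂ (inj₁ refl)) → along (sym a-2+2≡a) v∼a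
                                     ; _ (inj₂ (inj₂ refl)) → along (sym a-2+4≡a+2) v∼a+2 })
                          (inj₁ (inj₂ (inj₁ (sym a-2+2≡a)))) (inj₁ (inj₂ (inj₂ (sym a-2+4≡a+2))))
                          (inj₂ v≁a+4) (inj₁ (inj₁ refl)) (inj₂ v≁a-4)))
    ... | yes v∼a+2 | _ | _ | yes v∼a-4 = ⊥-elim (not-a+2-and-a-4 v∼a+2 v∼a-4)
    ... | _ | yes v∼a+4 | yes v∼a-2 | _ = ⊥-elim (not-a+4-and-a-2 v∼a+4 v∼a-2)
    ... | _ | yes v∼a+4 | _ | yes v∼a-4 = ⊥-elim (not-a+4-and-a-4 v∼a+4 v∼a-4)

  classification : ¬ HasInducedPath G k → ∃ (λ a → v ∼[ G ] c a) → ExactlyOneType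
  classification no-path (a , v∼a) =
    Incompatible.exactly-one (m≤m+n 7 (q * 2)) (Around.some-type a v∼a no-path)

lemma8 : (k : ℕ) .{{_ : NonZero k}} → 7 ≤ k → k % 2 ≡ 1 →
    ∀ {n} (G : Graph n) →
    ¬ HasInducedPath G k →
    (∀ ℓ → ℓ % 2 ≡ 1 → ℓ ≤ k ∸ 4 → ¬ HasCycleOfLength G ℓ) →
    (c : Fin k → Fin n) → IsInducedCycle G k c →
    (v : Fin n) → (∀ i → ¬ (v ≡ c i)) → (∃ λ i → v ∼[ G ] c i) →
    let A = ∃ λ i → NbrsOnCycleExactly G c v (λ j → j ≡ i ⊎ j ≡ shift i 2)
        B = ∃ λ i → NbrsOnCycleExactly G c v (λ j → j ≡ i ⊎ j ≡ shift i 4)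
        C = ∃ λ i → NbrsOnCycleExactly G c v (λ j → j ≡ i ⊎ j ≡ shift i 2 ⊎ j ≡ shift i 4)
    in (A × ¬ B × ¬ C) ⊎ (¬ A × B × ¬ C) ⊎ (¬ A × ¬ B × C)
lemma8 k 7≤k k-odd G no-path no-short-odd-cycle c cycle v v∉c has-neighbour
  with odd-from-7 k 7≤k k-odd
... | q , refl = Neighbourhood.classification q G no-short-odd-cycle c cycle v v∉c no-path has-neighbour
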